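{- Let $p\ge 3$ be a prime, and for $x\in\mathbb{N}$ let $$S_p(x)=\sum_{0\le n<x,\ n\equiv 0 \ (\mathrm{mod}\ p)}(-1)^{\sigma(n)},$$ where $\sigma(n)$ denotes the number of $1$'s in the binary expansion of $n$. Suppose that $$|S_p(n)|\le n^{\frac{\ln p}{(p-1)\ln 2}}\quad\text{for all integers } n\ge 2^p,$$ and that $p$ divides $S_p(2^p)$. Then $S_p(2^p)=\pm p$.
   Context: For $m,x\in\mathbb{N}$, $S_m(x)=\sum_{0\le n<x,\ m\mid n}(-1)^{\sigma(n)}$, where $\sigma(n)$ is the binary digit sum (number of ones in the binary expansion) of $n$. -}

module Defs where

open import Data.Nat using (ℕ; zero; suc; _%_; _/_)
import Data.Nat as ℕ
open import Data.Nat.Divisibility using (_∣?_)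
open import Data.Integer using (ℤ; 0ℤ; -1ℤ; _+_; _^_)
open import Data.Bool using (if_then_else_)
open import Relation.Nullary using (does)

-- binary digit sum with fuel; fuel n suffices for n (halving n times gives 0)
σ-aux : ℕ → ℕ → ℕ
σ-aux zero    _ = 0
σ-aux (suc k) n = (n % 2) ℕ.+ σ-aux k (n / 2)

σ : ℕ → ℕ
σ n = σ-aux n n

S : ℕ → ℕ → ℤ
S m zero    = 0ℤ
S m (suc x) = S m x + (if does (m ∣? x) then -1ℤ ^ σ x else 0ℤ)

{-# OPTIONS --safe #-}
module Submission where

-- At n = 2^p the hypothesis reads |S_p(2^p)| ≤ (2^p)^(log₂ p / (p-1)) = p^(p/(p-1)) < 3p,
-- so the multiple |S_p(2^p)| of p is 0, p or 2p.  Modulo 2 every summand (-1)^σ(n) is 1,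
-- hence S_p(2^p) has the parity of the number of multiples of p below 2^p.  By Fermat,
-- 2^p = jp + 2 with j even (p is odd), so these multiples are 0, p, …, jp: an odd number of
-- them.  Thus |S_p(2^p)| is odd and equals p.

open import Defs
open import Data.Nat
open import Data.Nat.Properties
open import Data.Nat.Divisibility
open import Data.Nat.Primality using (Prime; euclidsLemma; prime⇒irreducible; prime[2])
open import Data.Nat.Combinatorics using (_C_; nCk+nC[k+1]≡[n+1]C[k+1]; nC1≡n; nCn≡1; k>n⇒nCk≡0)
import Algebra.Properties.CommutativeSemigroup as CommutativeSemigroupProperties
open import Data.Nat.Tactic.RingSolver using (solve-∀)
open import Data.Integer as ℤ using (+_; -_; ∣_∣; -[1+_]; 0ℤ; 1ℤ; -1ℤ)
import Data.Integer.Properties as ℤ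
open import Data.Integer.Divisibility using () renaming (_∣_ to _∣ℤ_)
import Data.Integer.Divisibility.Signed as Signed
import Data.Integer.Tactic.RingSolver as ℤ-Solver
open import Data.Bool using (if_then_else_)
open import Data.Product using (∃-syntax; _×_; _,_)
open import Data.Sum using (_⊎_; inj₁; inj₂)
open import Data.Empty using (⊥-elim)
open import Relation.Nullary using (¬_; yes; no; does)
open import Relation.Nullary.Decidable using (dec-true; dec-false)
open import Relation.Binary.PropositionalEquality
open import Function using (_∘_)

∑< : ℕ → (ℕ → ℕ) → ℕ
∑< zero    f = 0
∑< (suc m) f = ∑< m f + f m

infix 10 ∑<
syntax ∑< m (λ k → e) = ∑[ k < m ] e

∑-shift : ∀ m (f : ℕ → ℕ) → ∑[ k < suc m ] f k ≡ f 0 + ∑[ k < m ] f (suc k)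
∑-shift zero    f = +-comm 0 (f 0)
∑-shift (suc m) f = trans (cong (_+ f (suc m)) (∑-shift m f)) (+-assoc (f 0) _ _)

∑-distrib-+ : ∀ m (f g : ℕ → ℕ) → ∑[ k < m ] (f k + g k) ≡ ∑[ k < m ] f k + ∑[ k < m ] g k
∑-distrib-+ zero    f g = refl
∑-distrib-+ (suc m) f g =
  trans (cong (_+ (f m + g m)) (∑-distrib-+ m f g)) (interchange (∑< m f) (∑< m g) (f m) (g m))
  where open CommutativeSemigroupProperties +-commutativeSemigroup

∣-∑ : ∀ {d} m (f : ℕ → ℕ) → (∀ k → k < m → d ∣ f k) → d ∣ ∑[ k < m ] f k
∣-∑ zero    f _   = _ ∣0
∣-∑ (suc m) f d∣f = ∣m∣n⇒∣m+n (∣-∑ m f λ k k<m → d∣f k (m<n⇒m<1+n k<m)) (d∣f m (n<1+n m))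

∑-cong : ∀ m {f g : ℕ → ℕ} → (∀ k → f k ≡ g k) → ∑[ k < m ] f k ≡ ∑[ k < m ] g k
∑-cong zero    f≗g = refl
∑-cong (suc m) f≗g = cong₂ _+_ (∑-cong m f≗g) (f≗g m)

∑-pascal : ∀ n m → ∑[ k < suc m ] (suc n C k) ≡ ∑[ k < m ] (n C k) + ∑[ k < suc m ] (n C k)
∑-pascal n m = begin
  ∑[ k < suc m ] (suc n C k)                         ≡⟨ ∑-shift m (suc n C_) ⟩
  1 + ∑[ k < m ] (suc n C suc k)                     ≡⟨ cong suc (∑-cong m pascal) ⟩
  1 + ∑[ k < m ] (n C k + n C suc k)                 ≡⟨ cong suc (∑-distrib-+ m (n C_) (λ k → n C suc k)) ⟩
  1 + (∑[ k < m ] (n C k) + ∑[ k < m ] (n C suc k))  ≡⟨ +-suc _ _ ⟨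
  ∑[ k < m ] (n C k) + (1 + ∑[ k < m ] (n C suc k))  ≡⟨ cong (λ x → ∑[ k < m ] (n C k) + x) (∑-shift m (n C_)) ⟨
  ∑[ k < m ] (n C k) + ∑[ k < suc m ] (n C k)        ∎
  where
  open ≡-Reasoning
  pascal : ∀ k → suc n C suc k ≡ n C k + n C suc k
  pascal k = sym (nCk+nC[k+1]≡[n+1]C[k+1] n k)

∑-nC≡2^n : ∀ n → ∑[ k < suc n ] (n C k) ≡ 2 ^ n
∑-nC≡2^n zero    = refl
∑-nC≡2^n (suc n) = begin
  ∑[ k < suc (suc n) ] (suc n C k)                        ≡⟨ ∑-pascal n (suc n) ⟩
  ∑[ k < suc n ] (n C k) + (∑[ k < suc n ] (n C k) + n C suc n)
    ≡⟨ cong (λ x → ∑[ k < suc n ] (n C k) + (∑[ k < suc n ] (n C k) + x)) (k>n⇒nCk≡0 (n<1+n n)) ⟩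
  ∑[ k < suc n ] (n C k) + (∑[ k < suc n ] (n C k) + 0)   ≡⟨ cong (λ x → x + (x + 0)) (∑-nC≡2^n n) ⟩
  2 ^ suc n                                               ∎
  where open ≡-Reasoning

[k+1]*[n+1]C[k+1]≡[n+1]*nCk : ∀ n k → suc k * (suc n C suc k) ≡ suc n * (n C k)
[k+1]*[n+1]C[k+1]≡[n+1]*nCk n       zero    =
  trans (+-identityʳ _) (trans (nC1≡n (suc n)) (sym (*-identityʳ (suc n))))
[k+1]*[n+1]C[k+1]≡[n+1]*nCk zero    (suc k) = *-zeroʳ (suc (suc k))
[k+1]*[n+1]C[k+1]≡[n+1]*nCk (suc n) (suc k) = begin
  suc (suc k) * (suc (suc n) C suc (suc k))       ≡⟨ cong (suc (suc k) *_) (nCk+nC[k+1]≡[n+1]C[k+1] (suc n) (suc k)) ⟨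
  suc (suc k) * (a + b)                           ≡⟨ regroup k a b ⟩
  a + suc k * a + suc (suc k) * b                 ≡⟨ cong₂ (λ x y → a + x + y) ([k+1]*[n+1]C[k+1]≡[n+1]*nCk n k)
                                                                             ([k+1]*[n+1]C[k+1]≡[n+1]*nCk n (suc k)) ⟩
  a + suc n * (n C k) + suc n * (n C suc k)       ≡⟨ collect n a (n C k) (n C suc k) ⟩
  a + suc n * (n C k + n C suc k)                 ≡⟨ cong (λ x → a + suc n * x) (nCk+nC[k+1]≡[n+1]C[k+1] n k) ⟩
  suc (suc n) * (suc n C suc k)                   ∎
  where
  open ≡-Reasoning
  a = suc n C suc k
  b = suc n C suc (suc k)
  regroup : ∀ k a b → suc (suc k) * (a + b) ≡ a + suc k * a + suc (suc k) * b
  regroup = solve-∀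
  collect : ∀ n a x y → a + suc n * x + suc n * y ≡ a + suc n * (x + y)
  collect = solve-∀

prime∣pCk : ∀ {p k} → Prime p → 0 < k → k < p → p ∣ p C k
prime∣pCk {suc n} {suc k} pr _ k<p
  with euclidsLemma (suc k) (suc n C suc k) pr
         (divides (n C k) (trans ([k+1]*[n+1]C[k+1]≡[n+1]*nCk n k) (*-comm (suc n) (n C k))))
... | inj₁ p∣k+1 = ⊥-elim (<⇒≱ k<p (∣⇒≤ p∣k+1))
... | inj₂ p∣pCk = p∣pCk

p∣2^p∸2 : ∀ {p} → Prime p → p ∣ 2 ^ p ∸ 2
p∣2^p∸2 {zero}  _  = 0 ∣0
p∣2^p∸2 {suc n} pr = subst (suc n ∣_) (sym 2^p∸2≡middle) (∣-∑ n middle-term p∣middle-term)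
  where
  middle-term : ℕ → ℕ
  middle-term k = suc n C suc k
  p∣middle-term : ∀ k → k < n → suc n ∣ middle-term k
  p∣middle-term k k<n = prime∣pCk pr (s≤s z≤n) (s≤s k<n)
  2^p∸2≡middle : 2 ^ suc n ∸ 2 ≡ ∑[ k < n ] middle-term k
  2^p∸2≡middle = begin
    2 ^ suc n ∸ 2
      ≡⟨ cong (_∸ 2) (∑-nC≡2^n (suc n)) ⟨
    ∑[ k < suc n ] (suc n C k) + suc n C suc n ∸ 2
      ≡⟨ cong₂ (λ x y → x + y ∸ 2) (∑-shift n (suc n C_)) (nCn≡1 (suc n)) ⟩
    1 + ∑[ k < n ] middle-term k + 1 ∸ 2
      ≡⟨ m+n∸n≡m _ 1 ⟩
    ∑[ k < n ] middle-term k
      ∎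
    where open ≡-Reasoning

multiplesBelow : ℕ → ℕ → ℕ
multiplesBelow m zero    = 0
multiplesBelow m (suc x) = multiplesBelow m x + (if does (m ∣? x) then 1 else 0)

multiplesBelow-suc-∣ : ∀ {m x} → m ∣ x → multiplesBelow m (suc x) ≡ suc (multiplesBelow m x)
multiplesBelow-suc-∣ {m} {x} m∣x =
  trans (cong (λ b → multiplesBelow m x + (if b then 1 else 0)) (dec-true (m ∣? x) m∣x)) (+-comm _ 1)

multiplesBelow-suc-∤ : ∀ {m x} → ¬ m ∣ x → multiplesBelow m (suc x) ≡ multiplesBelow m x
multiplesBelow-suc-∤ {m} {x} m∤x =
  trans (cong (λ b → multiplesBelow m x + (if b then 1 else 0)) (dec-false (m ∣? x) m∤x)) (+-identityʳ _)

multiplesBelow-+-∤ : ∀ {m} n r → (∀ i → i < r → ¬ m ∣ n + i) →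
                     multiplesBelow m (n + r) ≡ multiplesBelow m n
multiplesBelow-+-∤ n zero    _ = cong (multiplesBelow _) (+-identityʳ n)
multiplesBelow-+-∤ n (suc r) ∤ = begin
  multiplesBelow _ (n + suc r)   ≡⟨ cong (multiplesBelow _) (+-suc n r) ⟩
  multiplesBelow _ (suc (n + r)) ≡⟨ multiplesBelow-suc-∤ (∤ r (n<1+n r)) ⟩
  multiplesBelow _ (n + r)       ≡⟨ multiplesBelow-+-∤ n r (λ i i<r → ∤ i (m<n⇒m<1+n i<r)) ⟩
  multiplesBelow _ n             ∎
  where open ≡-Reasoning

multiplesBelow-+-period : ∀ m .{{_ : NonZero m}} n → multiplesBelow m (n + m) ≡ suc (multiplesBelow m n)
multiplesBelow-+-period m@(suc k) zero = multiplesBelow-+-∤ 1 k λ i i<k m∣1+i → <⇒≱ (s≤s i<k) (∣⇒≤ m∣1+i)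
multiplesBelow-+-period m (suc n) with m ∣? n | m ∣? (n + m)
... | yes _    | yes _      = cong (_+ 1) (multiplesBelow-+-period m n)
... | no  _    | no  _      = cong (_+ 0) (multiplesBelow-+-period m n)
... | yes m∣n  | no  m∤n+m  = ⊥-elim (m∤n+m (∣m∣n⇒∣m+n m∣n ∣-refl))
... | no  m∤n  | yes m∣n+m  = ⊥-elim (m∤n (∣m+n∣m⇒∣n (subst (m ∣_) (+-comm n m) m∣n+m) ∣-refl))

multiplesBelow-* : ∀ m .{{_ : NonZero m}} q → multiplesBelow m (q * m) ≡ q
multiplesBelow-* m zero    = refl
multiplesBelow-* m (suc q) = begin
  multiplesBelow m (m + q * m)   ≡⟨ cong (multiplesBelow m) (+-comm m (q * m)) ⟩
  multiplesBelow m (q * m + m)   ≡⟨ multiplesBelow-+-period m (q * m) ⟩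
  suc (multiplesBelow m (q * m)) ≡⟨ cong suc (multiplesBelow-* m q) ⟩
  suc q                          ∎
  where open ≡-Reasoning

multiplesBelow-*-+ : ∀ {m} q r → r < m → multiplesBelow m (q * m + suc r) ≡ suc q
multiplesBelow-*-+ {m@(suc k)} q r r<m = begin
  multiplesBelow m (q * m + suc r)   ≡⟨ cong (multiplesBelow m) (+-suc (q * m) r) ⟩
  multiplesBelow m (suc (q * m) + r) ≡⟨ multiplesBelow-+-∤ (suc (q * m)) r no-multiple ⟩
  multiplesBelow m (suc (q * m))     ≡⟨ multiplesBelow-suc-∣ (n∣m*n q) ⟩
  suc (multiplesBelow m (q * m))     ≡⟨ cong suc (multiplesBelow-* m q) ⟩
  suc q                              ∎
  where
  open ≡-Reasoning
  no-multiple : ∀ i → i < r → ¬ m ∣ suc (q * m) + i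
  no-multiple i i<r m∣ =
    <⇒≱ (≤-<-trans i<r r<m) (∣⇒≤ (∣m+n∣m⇒∣n (subst (m ∣_) (sym (+-suc (q * m) i)) m∣) (n∣m*n q)))

2∣[-1]^k-1 : ∀ k → + 2 Signed.∣ -1ℤ ℤ.^ k ℤ.- 1ℤ
2∣[-1]^k-1 zero          = Signed.divides 0ℤ refl
2∣[-1]^k-1 (suc zero)    = Signed.divides -1ℤ refl
2∣[-1]^k-1 (suc (suc k)) = subst (λ x → + 2 Signed.∣ x ℤ.- 1ℤ) (sym [-1]²) (2∣[-1]^k-1 k)
  where
  [-1]² : -1ℤ ℤ.* (-1ℤ ℤ.* -1ℤ ℤ.^ k) ≡ -1ℤ ℤ.^ k
  [-1]² = trans (sym (ℤ.*-assoc -1ℤ -1ℤ _)) (ℤ.*-identityˡ _)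

S≡multiplesBelow-mod-2 : ∀ m x → + 2 Signed.∣ S m x ℤ.- + multiplesBelow m x
S≡multiplesBelow-mod-2 m zero = Signed.divides 0ℤ refl
S≡multiplesBelow-mod-2 m (suc x) with m ∣? x
... | yes _ = subst (+ 2 Signed.∣_) (sym (regroup (S m x) (-1ℤ ℤ.^ σ x) (multiplesBelow m x)))
                    (Signed.∣m∣n⇒∣m+n (S≡multiplesBelow-mod-2 m x) (2∣[-1]^k-1 (σ x)))
  where
  regroup′ : ∀ s e c → s ℤ.+ e ℤ.- (c ℤ.+ 1ℤ) ≡ (s ℤ.- c) ℤ.+ (e ℤ.- 1ℤ)
  regroup′ = ℤ-Solver.solve-∀
  regroup : ∀ s e c → s ℤ.+ e ℤ.- + (c + 1) ≡ (s ℤ.- + c) ℤ.+ (e ℤ.- 1ℤ)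
  regroup s e c = trans (cong (λ z → s ℤ.+ e ℤ.- z) (ℤ.pos-+ c 1)) (regroup′ s e (+ c))
... | no  _ = subst (+ 2 Signed.∣_) (sym (cong₂ ℤ._-_ (ℤ.+-identityʳ (S m x)) (cong +_ (+-identityʳ _))))
                    (S≡multiplesBelow-mod-2 m x)

2∣∣S∣⇒2∣multiplesBelow : ∀ {m x} → 2 ∣ ∣ S m x ∣ → 2 ∣ multiplesBelow m x
2∣∣S∣⇒2∣multiplesBelow {m} {x} 2∣S =
  Signed.∣⇒∣ᵤ (subst (+ 2 Signed.∣_) (cancel (S m x) (+ multiplesBelow m x))
    (Signed.∣m∣n⇒∣m-n (Signed.∣ᵤ⇒∣ {i = S m x} 2∣S) (S≡multiplesBelow-mod-2 m x)))
  where
  cancel : ∀ s c → s ℤ.- (s ℤ.- c) ≡ c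
  cancel = ℤ-Solver.solve-∀

prime∧3≤p⇒2∤p : ∀ {p} → Prime p → 3 ≤ p → ¬ 2 ∣ p
prime∧3≤p⇒2∤p pr 3≤p 2∣p with prime⇒irreducible pr 2∣p
... | inj₂ refl = <⇒≱ 3≤p ≤-refl

multiplesBelow-2^p-odd : ∀ {p} → Prime p → 3 ≤ p → ¬ 2 ∣ multiplesBelow p (2 ^ p)
multiplesBelow-2^p-odd {p@(suc n)} pr 3≤p 2∣count
  with p∣2^p∸2 pr
... | divides j 2^p∸2≡j*p = 2∤1+j (subst (2 ∣_) count≡1+j 2∣count)
  where
  2^p≡2+j*p : 2 ^ p ≡ 2 + j * p
  2^p≡2+j*p = trans (sym (m+[n∸m]≡n (^-monoʳ-≤ 2 {1} {p} (s≤s z≤n)))) (cong (λ x → 2 + x) 2^p∸2≡j*p)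
  count≡1+j : multiplesBelow p (2 ^ p) ≡ suc j
  count≡1+j = trans (cong (multiplesBelow p) (trans 2^p≡2+j*p (+-comm 2 (j * p))))
                    (multiplesBelow-*-+ j 1 (≤-trans (s≤s (s≤s z≤n)) 3≤p))
  2∣j : 2 ∣ j
  2∣j with euclidsLemma j p prime[2] (∣m+n∣m⇒∣n (subst (2 ∣_) 2^p≡2+j*p (m∣m*n (2 ^ n))) ∣-refl)
  ... | inj₁ 2∣j = 2∣j
  ... | inj₂ 2∣p = ⊥-elim (prime∧3≤p⇒2∤p pr 3≤p 2∣p)
  2∤1+j : ¬ 2 ∣ suc j
  2∤1+j 2∣1+j with ∣1⇒≡1 (∣m+n∣m⇒∣n (subst (2 ∣_) (+-comm 1 j) 2∣1+j) 2∣j)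
  ... | ()

^-distrib-* : ∀ m n o → (m * n) ^ o ≡ m ^ o * n ^ o
^-distrib-* m n zero    = refl
^-distrib-* m n (suc o) = trans (cong (m * n *_) (^-distrib-* m n o)) (interchange m n (m ^ o) (n ^ o))
  where open CommutativeSemigroupProperties *-commutativeSemigroup

^-cancelˡ-≤ : ∀ n .{{_ : NonZero n}} {m o} → m ^ n ≤ o ^ n → m ≤ o
^-cancelˡ-≤ n {m} {o} mⁿ≤oⁿ with m ≤? o
... | yes m≤o = m≤o
... | no  m≰o = ⊥-elim (<⇒≱ (^-monoˡ-< n (≰⇒> m≰o)) mⁿ≤oⁿ)

^-cancelˡ-< : ∀ n {m o} → m ^ n < o ^ n → m < o
^-cancelˡ-< n {m} {o} mⁿ<oⁿ with m <? o
... | yes m<o = m<o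
... | no  m≮o = ⊥-elim (<⇒≱ mⁿ<oⁿ (^-monoˡ-≤ n (≮⇒≥ m≮o)))

∃[u]N<2^u≤2*N : ∀ N .{{_ : NonZero N}} → ∃[ u ] N < 2 ^ u × 2 ^ u ≤ 2 * N
∃[u]N<2^u≤2*N (suc zero)    = 1 , ≤-refl , ≤-refl
∃[u]N<2^u≤2*N (suc (suc N)) with ∃[u]N<2^u≤2*N (suc N)
... | u , 1+N<2^u , 2^u≤2+2N with suc (suc N) <? 2 ^ u
...   | yes 2+N<2^u = u , 2+N<2^u , ≤-trans 2^u≤2+2N (*-monoʳ-≤ 2 (n≤1+n (suc N)))
...   | no  2+N≮2^u =
  suc u , <-≤-trans (n<2*n (suc (suc N))) 2*[2+N]≤2^[1+u] , *-monoʳ-≤ 2 (≮⇒≥ 2+N≮2^u)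
  where
  n<2*n : ∀ n .{{_ : NonZero n}} → n < 2 * n
  n<2*n n = subst (n <_) (*-comm n 2) (m<m*n n 2 ≤-refl)
  2*[2+N]≤2^[1+u] : 2 * suc (suc N) ≤ 2 ^ suc u
  2*[2+N]≤2^[1+u] = *-monoʳ-≤ 2 1+N<2^u

2*[3+k]<3^[2+k] : ∀ k → 2 * (3 + k) < 3 ^ (2 + k)
2*[3+k]<3^[2+k] zero    = s≤s (s≤s (s≤s (s≤s (s≤s (s≤s (s≤s z≤n))))))
2*[3+k]<3^[2+k] (suc k) = begin-strict
  2 * (3 + suc k)                ≡⟨ *-distribˡ-+ 2 1 (3 + k) ⟩
  2 + 2 * (3 + k)                <⟨ +-monoʳ-< 2 (2*[3+k]<3^[2+k] k) ⟩
  2 + 3 ^ (2 + k)                ≤⟨ +-monoˡ-≤ (3 ^ (2 + k)) (*-monoʳ-≤ 2 (m^n>0 3 (2 + k))) ⟩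
  2 * 3 ^ (2 + k) + 3 ^ (2 + k)  ≡⟨ +-comm (2 * 3 ^ (2 + k)) _ ⟩
  3 ^ (3 + k)                    ∎
  where open ≤-Reasoning

-- The hypothesis says A ≤ (2^p)^(log₂ p / (p-1)) = p^(p/(p-1)); it is used at v = p(p-1) and
-- u with p^p < 2^u ≤ 2p^p, giving A^(p-1) ≤ 2^u ≤ 2p^p < (3p)^(p-1).
≤p^[p/[p-1]]⇒<3*p : ∀ {p} A → 3 ≤ p →
                    (∀ u v → p ^ v < 2 ^ (u * (p ∸ 1)) → A ^ v ≤ (2 ^ p) ^ u) → A < 3 * p
≤p^[p/[p-1]]⇒<3*p {p@(suc q@(suc (suc k)))} A (s≤s (s≤s (s≤s _))) A≤[2^p]^exponent
  with ∃[u]N<2^u≤2*N (p ^ p) {{m^n≢0 p p}}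
... | u , pᵖ<2ᵘ , 2ᵘ≤2*pᵖ = ^-cancelˡ-< q (≤-<-trans A^q≤2*pᵖ 2*pᵖ<[3*p]^q)
  where
  A^pq≤2^pu : A ^ (p * q) ≤ (2 ^ p) ^ u
  A^pq≤2^pu = A≤[2^p]^exponent u (p * q)
    (subst₂ _<_ (^-*-assoc p p q) (^-*-assoc 2 u q) (^-monoˡ-< q pᵖ<2ᵘ))
  A^q≤2*pᵖ : A ^ q ≤ 2 * p ^ p
  A^q≤2*pᵖ = ^-cancelˡ-≤ p (begin
    (A ^ q) ^ p      ≡⟨ ^-*-assoc A q p ⟩
    A ^ (q * p)      ≡⟨ cong (A ^_) (*-comm q p) ⟩
    A ^ (p * q)      ≤⟨ A^pq≤2^pu ⟩
    (2 ^ p) ^ u      ≡⟨ ^-*-assoc 2 p u ⟩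
    2 ^ (p * u)      ≡⟨ cong (2 ^_) (*-comm p u) ⟩
    2 ^ (u * p)      ≡⟨ ^-*-assoc 2 u p ⟨
    (2 ^ u) ^ p      ≤⟨ ^-monoˡ-≤ p 2ᵘ≤2*pᵖ ⟩
    (2 * p ^ p) ^ p  ∎)
    where open ≤-Reasoning
  2*pᵖ<[3*p]^q : 2 * p ^ p < (3 * p) ^ q
  2*pᵖ<[3*p]^q = begin-strict
    2 * (p * p ^ q) ≡⟨ *-assoc 2 p (p ^ q) ⟨
    2 * p * p ^ q   <⟨ *-monoˡ-< (p ^ q) {{m^n≢0 p q}} (2*[3+k]<3^[2+k] k) ⟩
    3 ^ q * p ^ q   ≡⟨ ^-distrib-* 3 p q ⟨
    (3 * p) ^ q     ∎
    where open ≤-Reasoning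

∣i∣≡n⇒i≡±n : ∀ {i n} → ∣ i ∣ ≡ n → i ≡ + n ⊎ i ≡ - + n
∣i∣≡n⇒i≡±n {+ _}      refl = inj₁ refl
∣i∣≡n⇒i≡±n { -[1+ _ ]} refl = inj₂ refl

odd-multiple<3⇒≡p : ∀ {n p} m → ¬ 2 ∣ n → n ≡ m * p → m < 3 → n ≡ p
odd-multiple<3⇒≡p         0               odd refl _ = ⊥-elim (odd (2 ∣0))
odd-multiple<3⇒≡p         1               _   refl _ = +-identityʳ _
odd-multiple<3⇒≡p {p = p} 2               odd refl _ = ⊥-elim (odd (m∣m*n p))
odd-multiple<3⇒≡p         (suc (suc (suc _))) _ _  (s≤s (s≤s (s≤s ())))

theorem2 : (p : ℕ) → Prime p → 3 ≤ p →
    (∀ n → 2 ^ p ≤ n → ∀ u v → p ^ v < 2 ^ (u * (p ∸ 1)) → ∣ S p n ∣ ^ v ≤ n ^ u) →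
    (+ p) ∣ℤ S p (2 ^ p) →
    (S p (2 ^ p) ≡ + p) ⊎ (S p (2 ^ p) ≡ - (+ p))
theorem2 p pr 3≤p bound (divides m ∣S∣≡m*p) =
  ∣i∣≡n⇒i≡±n (odd-multiple<3⇒≡p m ∣S∣-odd ∣S∣≡m*p m<3)
  where
  ∣S∣-odd : ¬ 2 ∣ ∣ S p (2 ^ p) ∣
  ∣S∣-odd = multiplesBelow-2^p-odd pr 3≤p ∘ 2∣∣S∣⇒2∣multiplesBelow {p} {2 ^ p}
  m<3 : m < 3
  m<3 = *-cancelʳ-< p m 3 (subst (_< 3 * p) ∣S∣≡m*p (≤p^[p/[p-1]]⇒<3*p _ 3≤p (bound (2 ^ p) ≤-refl)))
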